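{- Let $n$ be a positive integer and let $S,T$ be nonempty subsets of $[n-1]=\{1,\ldots,n-1\}$. Suppose there are integers $s\in S$ and $t\in T$ with $s+t\le n$ and $\gcd(s,t)=1$. Then $T_n\langle S;T\rangle$ is a walk-ensured Toeplitz matrix.
   Context: Matrices are Boolean ($0,1$ entries with $1+1=1$). For nonempty $S,T\subseteq[n-1]$, $T_n\langle S;T\rangle$ denotes the $n\times n$ $(0,1)$-matrix whose $(i,j)$-entry is $1$ if and only if $j-i\in S$ or $i-j\in T$. Its digraph $D(A)$ has vertex set $[n]=\{1,\ldots,n\}$ and an arc $(i,j)$ exactly when the $(i,j)$-entry is $1$. Let $s_1=\min S$ and $\gcd(S+T)=\gcd\{s+t: s\in S,t\in T\}$. The matrix $A=T_n\langle S;T\rangle$ is called walk-ensured if there is a positive integer $M$ such that for all vertices $u,v\in[n]$ and every integer $\ell\ge M$ with $v-u\equiv \ell s_1 \pmod{\gcd(S+T)}$, there is a directed walk from $u$ to $v$ of length $\ell$ in $D(A)$. -}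

module Defs where

open import Data.Nat using (ℕ; zero; suc; _+_; _*_; _≤_; _<_; _⊓_)
open import Data.Nat.GCD using (gcd)
open import Data.Fin using (Fin; toℕ)
open import Data.List using (List; []; _∷_; foldr; map; concatMap)
open import Data.List.Membership.Propositional using (_∈_)
open import Data.Product using (Σ; ∃; _×_; _,_)
open import Data.Sum using (_⊎_)
open import Data.Integer as ℤ using (ℤ; +_)
open import Data.Integer.Divisibility as ℤD using ()
open import Relation.Binary.PropositionalEquality using (_≡_)

-- Finite subsets of ℕ are represented by lists (duplicates/order irrelevant).
-- S ⊆ [n-1] = {1,…,n-1}.
_⊆[_-1] : List ℕ → ℕ → Set
S ⊆[ n -1] = ∀ {s} → s ∈ S → 1 ≤ s × s < n

NonEmpty : List ℕ → Set
NonEmpty S = ∃ λ s → s ∈ S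

-- min S (with min [] = 0, never used since S is assumed nonempty)
minL : List ℕ → ℕ
minL []       = 0
minL (x ∷ xs) = foldr _⊓_ x xs

gcdSum : List ℕ → List ℕ → ℕ
gcdSum S T = foldr gcd 0 (concatMap (λ s → map (λ t → s + t) T) S)

-- Vertices/indices [n] are represented by Fin n (index k stands for k+1;
-- only differences matter).  "entry (i,j) is 1" is a proposition.
Toeplitz : (n : ℕ) → List ℕ → List ℕ → Fin n → Fin n → Set
Toeplitz n S T i j =
  (Σ ℕ λ s → s ∈ S × toℕ j ≡ toℕ i + s) ⊎ (Σ ℕ λ t → t ∈ T × toℕ i ≡ toℕ j + t)

data Walk {n : ℕ} (A : Fin n → Fin n → Set) : Fin n → Fin n → ℕ → Set where
  here : ∀ {u} → Walk A u u 0
  step : ∀ {u w v ℓ} → A u w → Walk A w v ℓ → Walk A u v (suc ℓ)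

WalkEnsured : (n : ℕ) → List ℕ → List ℕ → Set
WalkEnsured n S T =
  ∃ λ M → 1 ≤ M × (∀ (u v : Fin n) (ℓ : ℕ) → M ≤ ℓ →
     (+ gcdSum S T) ℤD.∣ ((+ toℕ v) ℤ.- (+ toℕ u) ℤ.- (+ (ℓ * minL S))) →
     Walk (Toeplitz n S T) u v ℓ)

-- Let m = s + t.  Using only the arcs +s and −t, a walk can be steered greedily (down by t when
-- possible, otherwise up by s, which stays below n because s + t ≤ n), so x reaches y in a + b
-- steps whenever x + a·s = y + b·t; as gcd(s,t) = 1, Bézout provides such a, b for all x, y,
-- with a + b uniformly bounded.
-- The defect ℓ·s − (y − x) of a walk of length ℓ from x to y is additive; an arc +s′ has defect
-- s − s′, an arc −t′ has defect s + t′, and greedy walks have defect ≡ 0 (mod m).  Modulo m the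
-- defects of closed walks at the vertex 0 are closed under addition, hence form a subgroup; it
-- contains (s + t′) − (s − s′) = s′ + t′ for all s′ ∈ S, t′ ∈ T, and therefore gcd(S+T).
-- Now let v − u ≡ ℓ·s₁ (mod gcd(S+T)).  Since gcd(S+T) divides (s + t) − (s₁ + t), the defect
-- ℓ·s − (v − u) is a multiple of gcd(S+T), so some walk u → 0 → 0 → v of bounded length L has
-- L·s ≡ ℓ·s (mod m).  As s is invertible modulo m, m divides ℓ − L, and the walk is padded to
-- length ℓ by closed walks of length m (t steps up, s steps down).

module Submission where

open import Defs
open import Data.Nat using (ℕ; _+_; _≤_)
open import Data.Nat.GCD using (gcd)
open import Data.List using (List)
open import Data.List.Membership.Propositional using (_∈_)
open import Data.Product using (Σ; _×_)
open import Relation.Binary.PropositionalEquality using (_≡_)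

open import Data.Nat using (zero; suc; _*_; _∸_; _<_; _≤?_; _⊓_; pred; NonZero; z≤n; s≤s; >-nonZero)
open import Data.Nat.Properties
open import Data.Nat.Divisibility using (_∣_; divides; ∣-refl; ∣-trans)
open import Data.Nat.GCD using (gcd[m,n]∣m; gcd[m,n]∣n; gcd-GCD; module Bézout)
open import Data.Nat.Coprimality using (Coprime; coprime-Bézout; coprime-+; gcd≡1⇒coprime)
  renaming (sym to coprime-sym)
open import Data.Nat.Tactic.RingSolver using (solve-∀)
open import Data.Integer as ℤ using (ℤ; +_; -[1+_]; 0ℤ)
import Data.Integer.Properties as ℤₚ
import Data.Integer.Tactic.RingSolver as ℤ-Solver
open import Data.Integer.DivMod using (_%ℕ_; _/ℕ_; n%ℕd<d; a≡a%ℕn+[a/ℕn]*n)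
open import Data.Integer.Divisibility.Signed using (divides; ∣ᵤ⇒∣; ∣⇒∣ᵤ; ∣m∣n⇒∣m+n; ∣m∣n⇒∣m-n; ∣n⇒∣m*n)
  renaming (_∣_ to _∣ᶻ_)
open import Data.Integer.Divisibility using () renaming (_∣_ to _∣ᵤ_)
open import Data.Integer.Coprimality using (coprime-divisor)
open import Data.List using ([]; _∷_; map; concatMap)
open import Data.List.Properties using (foldr-preservesᵇ; foldr-forcesᵇ)
open import Data.List.Relation.Unary.All as All using (All)
open import Data.List.Relation.Unary.All.Properties using (concat⁺; concat⁻; map⁺; map⁻)
open import Data.List.Relation.Unary.Any using (here; there)
open import Data.Fin using (Fin; toℕ; fromℕ<)
open import Data.Fin.Properties using (toℕ-fromℕ<; toℕ<n; toℕ-injective)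
open import Data.Product using (_,_; proj₁; proj₂; ∃; ∃₂)
open import Data.Sum using (inj₁; inj₂; [_,_]′)
open import Relation.Binary.PropositionalEquality
  using (refl; sym; trans; cong; cong₂; subst; module ≡-Reasoning)
open import Relation.Nullary using (yes; no)

module _ {n : ℕ} {A : Fin n → Fin n → Set} where

  infixr 5 _++ʷ_

  _++ʷ_ : ∀ {x y z a b} → Walk A x y a → Walk A y z b → Walk A x z (a + b)
  here      ++ʷ w₂ = w₂
  step e w₁ ++ʷ w₂ = step e (w₁ ++ʷ w₂)

  replicateʷ : ∀ {x e} k → Walk A x x e → Walk A x x (k * e)
  replicateʷ zero    w = here
  replicateʷ (suc k) w = w ++ʷ replicateʷ k w

infix 4 _≡_mod_

_≡_mod_ : ℤ → ℤ → ℕ → Set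
_≡_mod_ i j m = + m ∣ᶻ i ℤ.- j

≡mod-reflexive : ∀ {m i j} → i ≡ j → i ≡ j mod m
≡mod-reflexive {i = i} refl = divides 0ℤ (ℤₚ.+-inverseʳ i)

≡mod-trans : ∀ {m i j k} → i ≡ j mod m → j ≡ k mod m → i ≡ k mod m
≡mod-trans {m} {i} {j} {k} p q = subst (+ m ∣ᶻ_) (lemma i j k) (∣m∣n⇒∣m+n p q)
  where
  lemma : ∀ i j k → (i ℤ.- j) ℤ.+ (j ℤ.- k) ≡ i ℤ.- k
  lemma = ℤ-Solver.solve-∀

≡mod-+ : ∀ {m i j k l} → i ≡ j mod m → k ≡ l mod m → i ℤ.+ k ≡ j ℤ.+ l mod m
≡mod-+ {m} {i} {j} {k} {l} p q = subst (+ m ∣ᶻ_) (lemma i j k l) (∣m∣n⇒∣m+n p q)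
  where
  lemma : ∀ i j k l → (i ℤ.- j) ℤ.+ (k ℤ.- l) ≡ (i ℤ.+ k) ℤ.- (j ℤ.+ l)
  lemma = ℤ-Solver.solve-∀

≡mod-cancelˡ : ∀ {m a i j} → Coprime m a → + a ℤ.* i ≡ + a ℤ.* j mod m → i ≡ j mod m
≡mod-cancelˡ {m} {a} {i} {j} m⊥a p =
  ∣ᵤ⇒∣ (coprime-divisor (+ m) (+ a) (i ℤ.- j) m⊥a (∣⇒∣ᵤ (subst (+ m ∣ᶻ_) (lemma (+ a) i j) p)))
  where
  lemma : ∀ a i j → a ℤ.* i ℤ.- a ℤ.* j ≡ a ℤ.* (i ℤ.- j)
  lemma = ℤ-Solver.solve-∀

+≡+mod⇒∣∸ : ∀ {m a b} → a ≤ b → + a ≡ + b mod m → m ∣ b ∸ a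
+≡+mod⇒∣∸ {m} {a} {b} a≤b p =
  subst (m ∣_) (trans (cong ℤ.∣_∣ (ℤₚ.[+m]-[+n]≡m⊖n a b)) (ℤₚ.∣⊖∣-≤ a≤b)) (∣⇒∣ᵤ p)

pred[m]*i≡-i : ∀ m .{{_ : NonZero m}} i → + pred m ℤ.* i ≡ ℤ.- i mod m
pred[m]*i≡-i m i = divides i (trans (lemma (+ pred m) i) (cong (λ k → i ℤ.* + k) (suc-pred m)))
  where
  lemma : ∀ p i → p ℤ.* i ℤ.- ℤ.- i ≡ i ℤ.* (ℤ.1ℤ ℤ.+ p)
  lemma = ℤ-Solver.solve-∀

[z%m]*i≡z*i : ∀ m .{{_ : NonZero m}} z i → + (z %ℕ m) ℤ.* i ≡ z ℤ.* i mod m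
[z%m]*i≡z*i m z i = divides (ℤ.- (z /ℕ m ℤ.* i)) (begin
  + r ℤ.* i ℤ.- z ℤ.* i                         ≡⟨ cong (λ w → + r ℤ.* i ℤ.- w ℤ.* i) (a≡a%ℕn+[a/ℕn]*n z m) ⟩
  + r ℤ.* i ℤ.- (+ r ℤ.+ z /ℕ m ℤ.* + m) ℤ.* i  ≡⟨ lemma (+ r) i (z /ℕ m) (+ m) ⟩
  ℤ.- (z /ℕ m ℤ.* i) ℤ.* + m                    ∎)
  where
  open ≡-Reasoning
  r : ℕ
  r = z %ℕ m
  lemma : ∀ r i q m → r ℤ.* i ℤ.- (r ℤ.+ q ℤ.* m) ℤ.* i ≡ ℤ.- (q ℤ.* i) ℤ.* m
  lemma = ℤ-Solver.solve-∀

pos-+-* : ∀ x a b → + (x + a * b) ≡ + x ℤ.+ + a ℤ.* + b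
pos-+-* x a b = cong (ℤ._+_ (+ x)) (ℤₚ.pos-* a b)

coprime⇒∃[x,y]1+x*m≡y*n : ∀ {m n} → 0 < n → Coprime m n → ∃₂ λ x y → 1 + x * m ≡ y * n
coprime⇒∃[x,y]1+x*m≡y*n {m} {suc n} _ m⊥n with coprime-Bézout m⊥n
... | Bézout.-+ x y 1+xm≡yn = x , y , 1+xm≡yn
... | Bézout.+- x y 1+yn≡xm = x * n , 1 + y * n , (begin
  1 + x * n * m            ≡⟨ lemma₁ x n m ⟩
  1 + n * (x * m)          ≡⟨ cong (λ z → 1 + n * z) (sym 1+yn≡xm) ⟩
  1 + n * (1 + y * suc n)  ≡⟨ lemma₂ y n ⟩
  (1 + y * n) * suc n      ∎)
  where
  open ≡-Reasoning
  lemma₁ : ∀ x n m → 1 + x * n * m ≡ 1 + n * (x * m)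
  lemma₁ = solve-∀
  lemma₂ : ∀ y n → 1 + n * (1 + y * suc n) ≡ (1 + y * n) * suc n
  lemma₂ = solve-∀

coprime⇒∃[a,b]x+a*m≡y+b*n : ∀ {m n} → 0 < m → 0 < n → Coprime m n →
  ∃ λ K → ∀ x y → ∃₂ λ a b → a + b ≤ (x + y) * K × x + a * m ≡ y + b * n
coprime⇒∃[a,b]x+a*m≡y+b*n {m} {n} 0<m 0<n m⊥n
  with coprime⇒∃[x,y]1+x*m≡y*n 0<n m⊥n | coprime⇒∃[x,y]1+x*m≡y*n 0<m (coprime-sym m⊥n)
... | X , Y , 1+Xm≡Yn | Y′ , X′ , 1+Y′n≡X′m =
  K , λ x y → x * X + y * X′ , x * Y + y * Y′ , bound x y , solution x y
  where
  K : ℕ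
  K = (X + Y) + (X′ + Y′)

  bound : ∀ x y → (x * X + y * X′) + (x * Y + y * Y′) ≤ (x + y) * K
  bound x y = begin
    (x * X + y * X′) + (x * Y + y * Y′)  ≡⟨ lemma x y X Y X′ Y′ ⟩
    x * (X + Y) + y * (X′ + Y′)          ≤⟨ +-mono-≤ (*-monoʳ-≤ x (m≤m+n (X + Y) (X′ + Y′)))
                                                      (*-monoʳ-≤ y (m≤n+m (X′ + Y′) (X + Y))) ⟩
    x * K + y * K                        ≡⟨ *-distribʳ-+ K x y ⟨
    (x + y) * K                          ∎
    where
    open ≤-Reasoning
    lemma : ∀ x y X Y X′ Y′ → (x * X + y * X′) + (x * Y + y * Y′) ≡ x * (X + Y) + y * (X′ + Y′)
    lemma = solve-∀

  solution : ∀ x y → x + (x * X + y * X′) * m ≡ y + (x * Y + y * Y′) * n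
  solution x y = begin
    x + (x * X + y * X′) * m         ≡⟨ lemma₁ x y X X′ m ⟩
    x * (1 + X * m) + y * (X′ * m)   ≡⟨ cong₂ (λ p q → x * p + y * q) 1+Xm≡Yn (sym 1+Y′n≡X′m) ⟩
    x * (Y * n) + y * (1 + Y′ * n)   ≡⟨ lemma₂ x y Y Y′ n ⟩
    y + (x * Y + y * Y′) * n         ∎
    where
    open ≡-Reasoning
    lemma₁ : ∀ x y X X′ m → x + (x * X + y * X′) * m ≡ x * (1 + X * m) + y * (X′ * m)
    lemma₁ = solve-∀
    lemma₂ : ∀ x y Y Y′ n → x * (Y * n) + y * (1 + Y′ * n) ≡ y + (x * Y + y * Y′) * n
    lemma₂ = solve-∀

Bézout⇒∃[i,j]d≡i*a+j*b : ∀ {d a b} → Bézout.Identity d a b → ∃₂ λ i j → + d ≡ i ℤ.* + a ℤ.+ j ℤ.* + b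
Bézout⇒∃[i,j]d≡i*a+j*b {d} {a} {b} (Bézout.+- x y d+yb≡xa) = + x , ℤ.- + y , (begin
  + d                                        ≡⟨ lemma (+ d) (+ y) (+ b) ⟩
  (+ d ℤ.+ + y ℤ.* + b) ℤ.+ ℤ.- + y ℤ.* + b  ≡⟨ cong (ℤ._+ ℤ.- + y ℤ.* + b) d+yb≡xaᶻ ⟩
  + x ℤ.* + a ℤ.+ ℤ.- + y ℤ.* + b            ∎)
  where
  open ≡-Reasoning
  d+yb≡xaᶻ : + d ℤ.+ + y ℤ.* + b ≡ + x ℤ.* + a
  d+yb≡xaᶻ = trans (sym (pos-+-* d y b)) (trans (cong +_ d+yb≡xa) (ℤₚ.pos-* x a))
  lemma : ∀ d y b → d ≡ (d ℤ.+ y ℤ.* b) ℤ.+ ℤ.- y ℤ.* b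
  lemma = ℤ-Solver.solve-∀
Bézout⇒∃[i,j]d≡i*a+j*b {d} {a} {b} (Bézout.-+ x y d+xa≡yb) = ℤ.- + x , + y , (begin
  + d                                        ≡⟨ lemma (+ d) (+ x) (+ a) ⟩
  ℤ.- + x ℤ.* + a ℤ.+ (+ d ℤ.+ + x ℤ.* + a)  ≡⟨ cong (ℤ._+_ (ℤ.- + x ℤ.* + a)) d+xa≡ybᶻ ⟩
  ℤ.- + x ℤ.* + a ℤ.+ + y ℤ.* + b            ∎)
  where
  open ≡-Reasoning
  d+xa≡ybᶻ : + d ℤ.+ + x ℤ.* + a ≡ + y ℤ.* + b
  d+xa≡ybᶻ = trans (sym (pos-+-* d x a)) (trans (cong +_ d+xa≡yb) (ℤₚ.pos-* y b))
  lemma : ∀ d x a → d ≡ ℤ.- x ℤ.* a ℤ.+ (d ℤ.+ x ℤ.* a)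
  lemma = ℤ-Solver.solve-∀

minL∈ : ∀ {S} → NonEmpty S → minL S ∈ S
minL∈ {[]}     (_ , ())
minL∈ {x ∷ xs} _ = foldr-preservesᵇ ⊓-closed (here refl) (All.tabulate there)
  where
  ⊓-closed : ∀ {a b} → a ∈ x ∷ xs → b ∈ x ∷ xs → a ⊓ b ∈ x ∷ xs
  ⊓-closed {a} {b} a∈ b∈ =
    [ (λ eq → subst (_∈ x ∷ xs) (sym eq) a∈) , (λ eq → subst (_∈ x ∷ xs) (sym eq) b∈) ]′ (⊓-sel a b)

pairSums : List ℕ → List ℕ → List ℕ
pairSums S T = concatMap (λ s → map (λ t → s + t) T) S

module _ {P : ℕ → Set} {S T : List ℕ} where

  All-pairSums⁺ : (∀ {s t} → s ∈ S → t ∈ T → P (s + t)) → All P (pairSums S T)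
  All-pairSums⁺ P[s+t] = concat⁺ (map⁺ (All.tabulate λ s∈S → map⁺ (All.tabulate (P[s+t] s∈S))))

  All-pairSums⁻ : All P (pairSums S T) → ∀ {s t} → s ∈ S → t ∈ T → P (s + t)
  All-pairSums⁻ all s∈S t∈T = All.lookup (map⁻ (All.lookup (map⁻ (concat⁻ all)) s∈S)) t∈T

gcdSum∣ : ∀ {S T s t} → s ∈ S → t ∈ T → gcdSum S T ∣ s + t
gcdSum∣ {S} {T} = All-pairSums⁻ (foldr-forcesᵇ {P = gcdSum S T ∣_} gcd-forces 0 (pairSums S T) ∣-refl)
  where
  gcd-forces : ∀ a b → gcdSum S T ∣ gcd a b → gcdSum S T ∣ a × gcdSum S T ∣ b
  gcd-forces a b g∣ = ∣-trans g∣ (gcd[m,n]∣m a b) , ∣-trans g∣ (gcd[m,n]∣n a b)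

gcdSum-preserves : ∀ {S T} (P : ℕ → Set) → P 0 → (∀ {a b} → P a → P b → P (gcd a b)) →
                   (∀ {s t} → s ∈ S → t ∈ T → P (s + t)) → P (gcdSum S T)
gcdSum-preserves P P[0] P[gcd] P[s+t] = foldr-preservesᵇ {P = P} P[gcd] P[0] (All-pairSums⁺ P[s+t])

module ToeplitzWalks {n : ℕ} {S T : List ℕ} (S⊆ : S ⊆[ n -1]) (T⊆ : T ⊆[ n -1])
                     {s t : ℕ} (s∈S : s ∈ S) (t∈T : t ∈ T) (s+t≤n : s + t ≤ n) where

  A : Fin n → Fin n → Set
  A = Toeplitz n S T

  down : Fin n → Fin n
  down x = fromℕ< (≤-<-trans (m∸n≤m (toℕ x) t) (toℕ<n x))

  down-≡ : ∀ {x : Fin n} → t ≤ toℕ x → toℕ x ≡ toℕ (down x) + t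
  down-≡ {x} t≤x = trans (sym (m∸n+n≡m t≤x)) (cong (_+ t) (sym (toℕ-fromℕ< _)))

  step-up : ∀ {x y ℓ} (p : toℕ x + s < n) → Walk A (fromℕ< p) y ℓ → Walk A x y (suc ℓ)
  step-up p = step (inj₁ (s , s∈S , toℕ-fromℕ< p))

  step-down : ∀ {x y ℓ} → t ≤ toℕ x → Walk A (down x) y ℓ → Walk A x y (suc ℓ)
  step-down t≤x = step (inj₂ (t , t∈T , down-≡ t≤x))

  after-up : ∀ {x : Fin n} {a r} (p : toℕ x + s < n) → toℕ x + suc a * s ≡ r → toℕ (fromℕ< p) + a * s ≡ r
  after-up {x} {a} p eq = trans (cong (_+ a * s) (toℕ-fromℕ< p)) (trans (+-assoc (toℕ x) s (a * s)) eq)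

  after-down : ∀ {x : Fin n} {c r b} → t ≤ toℕ x → toℕ x + c ≡ r + suc b * t → toℕ (down x) + c ≡ r + b * t
  after-down {x} {c} {r} {b} t≤x eq = +-cancelʳ-≡ t _ _ (begin
    toℕ (down x) + c + t    ≡⟨ lemma₁ (toℕ (down x)) c t ⟩
    toℕ (down x) + t + c    ≡⟨ cong (_+ c) (down-≡ t≤x) ⟨
    toℕ x + c               ≡⟨ eq ⟩
    r + (t + b * t)         ≡⟨ lemma₂ r t (b * t) ⟩
    r + b * t + t           ∎)
    where
    open ≡-Reasoning
    lemma₁ : ∀ x y z → x + y + z ≡ x + z + y
    lemma₁ = solve-∀
    lemma₂ : ∀ x y z → x + (y + z) ≡ x + z + y
    lemma₂ = solve-∀

  greedy : ∀ {x y : Fin n} a b → toℕ x + a * s ≡ toℕ y + b * t → Walk A x y (a + b)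
  greedy {x} zero zero eq = subst (λ y → Walk A x y 0) (toℕ-injective (+-cancelʳ-≡ 0 _ _ eq)) here
  greedy {x} {y} (suc a) zero eq = step-up x+s<n (greedy a zero (after-up {a = a} x+s<n eq))
    where
    x+s<n : toℕ x + s < n
    x+s<n = ≤-<-trans (≤-trans (+-monoʳ-≤ (toℕ x) (m≤m+n s (a * s))) (≤-reflexive (trans eq (+-identityʳ _))))
                      (toℕ<n y)
  greedy {x} {y} zero (suc b) eq =
    step-down t≤x (greedy zero b (after-down {r = toℕ y} {b = b} t≤x eq))
    where
    t≤x : t ≤ toℕ x
    t≤x = ≤-trans (≤-trans (m≤m+n t (b * t)) (m≤n+m _ (toℕ y))) (≤-reflexive (trans (sym eq) (+-identityʳ _)))
  greedy {x} {y} (suc a) (suc b) eq with t ≤? toℕ x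
  ... | yes t≤x = subst (Walk A x y) (cong suc (sym (+-suc a b)))
                        (step-down t≤x (greedy (suc a) b (after-down {r = toℕ y} {b = b} t≤x eq)))
  ... | no t≰x  = step-up x+s<n (greedy a (suc b) (after-up {a = a} x+s<n eq))
    where
    x+s<n : toℕ x + s < n
    x+s<n = ≤-trans (+-monoˡ-≤ s (≰⇒> t≰x)) (≤-trans (≤-reflexive (+-comm t s)) s+t≤n)

  m : ℕ
  m = s + t

  0<s : 0 < s
  0<s = proj₁ (S⊆ s∈S)

  0<t : 0 < t
  0<t = proj₁ (T⊆ t∈T)

  instance
    m-nonZero : NonZero m
    m-nonZero = >-nonZero (≤-trans 0<s (m≤m+n s t))

  cycle : ∀ x → Walk A x x m
  cycle x = subst (Walk A x x) (+-comm t s) (greedy {x} {x} t s (cong (_+_ (toℕ x)) (*-comm t s)))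

  pad : ∀ {x y L ℓ} → Walk A x y L → L ≤ ℓ → m ∣ ℓ ∸ L → Walk A x y ℓ
  pad {x} {y} {L} w L≤ℓ (divides k ℓ∸L≡k*m) =
    subst (Walk A x y) (trans (cong (_+ L) (sym ℓ∸L≡k*m)) (m∸n+n≡m L≤ℓ)) (replicateʷ k (cycle x) ++ʷ w)

  defect : Fin n → Fin n → ℕ → ℤ
  defect x y ℓ = + ℓ ℤ.* + s ℤ.- (+ toℕ y ℤ.- + toℕ x)

  record DWalk (x y : Fin n) (ℓ : ℕ) (c : ℤ) : Set where
    constructor dwalk
    field
      walk    : Walk A x y ℓ
      defect≡ : defect x y ℓ ≡ c mod m

  DWalk-here : ∀ {x} → DWalk x x 0 0ℤ
  DWalk-here {x} = dwalk here (≡mod-reflexive (lemma (+ s) (+ toℕ x)))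
    where
    lemma : ∀ s x → + 0 ℤ.* s ℤ.- (x ℤ.- x) ≡ 0ℤ
    lemma = ℤ-Solver.solve-∀

  infixr 5 _++ᵈ_

  _++ᵈ_ : ∀ {x y z a b c d} → DWalk x y a c → DWalk y z b d → DWalk x z (a + b) (c ℤ.+ d)
  _++ᵈ_ {x} {y} {z} {a} {b} (dwalk w₁ p₁) (dwalk w₂ p₂) =
    dwalk (w₁ ++ʷ w₂) (subst (_≡ _ mod m) (sym (lemma (+ a) (+ b) (+ s) (+ toℕ x) (+ toℕ y) (+ toℕ z)))
                             (≡mod-+ {i = defect x y a} {k = defect y z b} p₁ p₂))
    where
    lemma : ∀ a b s x y z → (a ℤ.+ b) ℤ.* s ℤ.- (z ℤ.- x) ≡ (a ℤ.* s ℤ.- (y ℤ.- x)) ℤ.+ (b ℤ.* s ℤ.- (z ℤ.- y))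
    lemma = ℤ-Solver.solve-∀

  DWalk-resp : ∀ {x y ℓ c d} → c ≡ d mod m → DWalk x y ℓ c → DWalk x y ℓ d
  DWalk-resp {x} {y} {ℓ} c≡d (dwalk w p) = dwalk w (≡mod-trans {i = defect x y ℓ} p c≡d)

  DWalk-replicate : ∀ {x e c} k → DWalk x x e c → DWalk x x (k * e) (+ k ℤ.* c)
  DWalk-replicate zero    w = DWalk-here
  DWalk-replicate {c = c} (suc k) w =
    subst (DWalk _ _ _) (sym (ℤₚ.suc-* (+ k) c)) (w ++ᵈ DWalk-replicate k w)

  arc-upᵈ : ∀ {x y s′} → s′ ∈ S → toℕ y ≡ toℕ x + s′ → DWalk x y 1 (+ s ℤ.- + s′)
  arc-upᵈ {x} {y} {s′} s′∈S eq = dwalk (step (inj₁ (s′ , s′∈S , eq)) here) (≡mod-reflexive (begin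
    + 1 ℤ.* + s ℤ.- (+ toℕ y ℤ.- + toℕ x)          ≡⟨ cong (λ j → + 1 ℤ.* + s ℤ.- (+ j ℤ.- + toℕ x)) eq ⟩
    + 1 ℤ.* + s ℤ.- (+ toℕ x ℤ.+ + s′ ℤ.- + toℕ x)  ≡⟨ lemma (+ s) (+ toℕ x) (+ s′) ⟩
    + s ℤ.- + s′                                    ∎))
    where
    open ≡-Reasoning
    lemma : ∀ s x s′ → + 1 ℤ.* s ℤ.- (x ℤ.+ s′ ℤ.- x) ≡ s ℤ.- s′
    lemma = ℤ-Solver.solve-∀

  arc-downᵈ : ∀ {x y t′} → t′ ∈ T → toℕ x ≡ toℕ y + t′ → DWalk x y 1 (+ s ℤ.+ + t′)
  arc-downᵈ {x} {y} {t′} t′∈T eq = dwalk (step (inj₂ (t′ , t′∈T , eq)) here) (≡mod-reflexive (begin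
    + 1 ℤ.* + s ℤ.- (+ toℕ y ℤ.- + toℕ x)          ≡⟨ cong (λ j → + 1 ℤ.* + s ℤ.- (+ toℕ y ℤ.- + j)) eq ⟩
    + 1 ℤ.* + s ℤ.- (+ toℕ y ℤ.- (+ toℕ y ℤ.+ + t′))  ≡⟨ lemma (+ s) (+ toℕ y) (+ t′) ⟩
    + s ℤ.+ + t′                                    ∎))
    where
    open ≡-Reasoning
    lemma : ∀ s y t′ → + 1 ℤ.* s ℤ.- (y ℤ.- (y ℤ.+ t′)) ≡ s ℤ.+ t′
    lemma = ℤ-Solver.solve-∀

  greedyᵈ : ∀ {x y : Fin n} a b → toℕ x + a * s ≡ toℕ y + b * t → DWalk x y (a + b) 0ℤ
  greedyᵈ {x} {y} a b eq = dwalk (greedy a b eq) (divides (+ b) (begin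
    defect x y (a + b) ℤ.- 0ℤ           ≡⟨ lemma₁ X Y (+ a) (+ b) (+ s) (+ t) ⟩
    (X ℤ.+ + a ℤ.* + s) ℤ.- R ℤ.+ bm   ≡⟨ cong (λ j → j ℤ.- R ℤ.+ bm) eqᶻ ⟩
    R ℤ.- R ℤ.+ bm                      ≡⟨ lemma₂ R bm ⟩
    bm                                  ∎))
    where
    open ≡-Reasoning
    X Y R bm : ℤ
    X  = + toℕ x
    Y  = + toℕ y
    R  = Y ℤ.+ + b ℤ.* + t
    bm = + b ℤ.* + m
    eqᶻ : X ℤ.+ + a ℤ.* + s ≡ R
    eqᶻ = trans (sym (pos-+-* (toℕ x) a s)) (trans (cong +_ eq) (pos-+-* (toℕ y) b t))
    lemma₁ : ∀ x y a b s t →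
             (a ℤ.+ b) ℤ.* s ℤ.- (y ℤ.- x) ℤ.- 0ℤ ≡ (x ℤ.+ a ℤ.* s) ℤ.- (y ℤ.+ b ℤ.* t) ℤ.+ b ℤ.* (s ℤ.+ t)
    lemma₁ = ℤ-Solver.solve-∀
    lemma₂ : ∀ i j → i ℤ.- i ℤ.+ j ≡ j
    lemma₂ = ℤ-Solver.solve-∀

  module _ (s⊥t : Coprime s t) where

    connect : ∃ λ B → ∀ x y → ∃ λ ℓ → ℓ ≤ B × DWalk x y ℓ 0ℤ
    connect with coprime⇒∃[a,b]x+a*m≡y+b*n 0<s 0<t s⊥t
    ... | K , solution = (n + n) * K , λ x y →
      let (a , b , a+b≤ , eq) = solution (toℕ x) (toℕ y)
      in a + b , ≤-trans a+b≤ (*-monoˡ-≤ K (+-mono-≤ (<⇒≤ (toℕ<n x)) (<⇒≤ (toℕ<n y)))) , greedyᵈ a b eq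

    m∣ℓ∸L : ∀ {x y L ℓ} → defect x y L ≡ defect x y ℓ mod m → L ≤ ℓ → m ∣ ℓ ∸ L
    m∣ℓ∸L {x} {y} {L} {ℓ} p L≤ℓ = +≡+mod⇒∣∸ L≤ℓ (≡mod-cancelˡ (coprime-+ (coprime-sym s⊥t)) s*L≡s*ℓ)
      where
      s*L≡s*ℓ : + s ℤ.* + L ≡ + s ℤ.* + ℓ mod m
      s*L≡s*ℓ = subst (+ m ∣ᶻ_) (lemma (+ L) (+ ℓ) (+ s) (+ toℕ x) (+ toℕ y)) p
        where
        lemma : ∀ L ℓ s x y → L ℤ.* s ℤ.- (y ℤ.- x) ℤ.- (ℓ ℤ.* s ℤ.- (y ℤ.- x)) ≡ s ℤ.* L ℤ.- s ℤ.* ℓ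
        lemma = ℤ-Solver.solve-∀

    lengthen : ∀ {x y L ℓ} → DWalk x y L (defect x y ℓ) → L ≤ ℓ → Walk A x y ℓ
    lengthen {x} {y} {L} {ℓ} (dwalk w p) L≤ℓ = pad w L≤ℓ (m∣ℓ∸L {x} {y} {L} {ℓ} p L≤ℓ)

    o : Fin n
    o = fromℕ< (≤-<-trans z≤n (proj₂ (S⊆ s∈S)))

    toℕ-o : toℕ o ≡ 0
    toℕ-o = toℕ-fromℕ< _

    Attainable : ℤ → Set
    Attainable c = ∃ λ e → DWalk o o e c

    attainable-+ : ∀ {c d} → Attainable c → Attainable d → Attainable (c ℤ.+ d)
    attainable-+ (e₁ , w₁) (e₂ , w₂) = e₁ + e₂ , w₁ ++ᵈ w₂

    attainable-neg : ∀ {c} → Attainable c → Attainable (ℤ.- c)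
    attainable-neg {c} (e , w) = pred m * e , DWalk-resp (pred[m]*i≡-i m c) (DWalk-replicate (pred m) w)

    attainable-* : ∀ {c} i → Attainable c → Attainable (i ℤ.* c)
    attainable-* (+ k)    (e , w) = k * e , DWalk-replicate k w
    attainable-* {c} -[1+ k ] a =
      subst Attainable (ℤₚ.neg-distribˡ-* (+ suc k) c) (attainable-neg (attainable-* (+ suc k) a))

    attainable-gcd : ∀ {a b} → Attainable (+ a) → Attainable (+ b) → Attainable (+ gcd a b)
    attainable-gcd {a} {b} A[a] A[b] with Bézout⇒∃[i,j]d≡i*a+j*b (Bézout.identity (gcd-GCD a b))
    ... | i , j , d≡ia+jb =
      subst Attainable (sym d≡ia+jb) (attainable-+ (attainable-* i A[a]) (attainable-* j A[b]))

    attainable-s-s′ : ∀ {s′} → s′ ∈ S → Attainable (+ s ℤ.- + s′)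
    attainable-s-s′ {s′} s′∈S =
      let v = fromℕ< (proj₂ (S⊆ s′∈S))
          (ℓ , _ , v→o) = proj₂ connect v o
      in 1 + ℓ , subst (DWalk o o (1 + ℓ)) (ℤₚ.+-identityʳ (+ s ℤ.- + s′))
                       (arc-upᵈ s′∈S (trans (toℕ-fromℕ< _) (cong (_+ s′) (sym toℕ-o))) ++ᵈ v→o)

    attainable-s+t′ : ∀ {t′} → t′ ∈ T → Attainable (+ s ℤ.+ + t′)
    attainable-s+t′ {t′} t′∈T =
      let v = fromℕ< (proj₂ (T⊆ t′∈T))
          (ℓ , _ , o→v) = proj₂ connect o v
      in ℓ + 1 , subst (DWalk o o (ℓ + 1)) (ℤₚ.+-identityˡ (+ s ℤ.+ + t′))
                       (o→v ++ᵈ arc-downᵈ t′∈T (trans (toℕ-fromℕ< _) (cong (_+ t′) (sym toℕ-o))))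

    attainable-s′+t′ : ∀ {s′ t′} → s′ ∈ S → t′ ∈ T → Attainable (+ (s′ + t′))
    attainable-s′+t′ {s′} {t′} s′∈S t′∈T =
      subst Attainable (lemma (+ s) (+ s′) (+ t′))
            (attainable-+ (attainable-s+t′ t′∈T) (attainable-neg (attainable-s-s′ s′∈S)))
      where
      lemma : ∀ s s′ t′ → s ℤ.+ t′ ℤ.+ ℤ.- (s ℤ.- s′) ≡ s′ ℤ.+ t′
      lemma = ℤ-Solver.solve-∀

    attainable-gcdSum : Attainable (+ gcdSum S T)
    attainable-gcdSum =
      gcdSum-preserves (λ a → Attainable (+ a)) (0 , DWalk-here) attainable-gcd attainable-s′+t′

    attainable-bounded : ∃ λ B → ∀ c → + gcdSum S T ∣ᶻ c → ∃ λ e → e ≤ B × DWalk o o e c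
    attainable-bounded = m * e , bounded
      where
      e : ℕ
      e = proj₁ attainable-gcdSum
      bounded : ∀ c → + gcdSum S T ∣ᶻ c → ∃ λ e′ → e′ ≤ m * e × DWalk o o e′ c
      bounded c (divides z refl) =
        z %ℕ m * e , *-monoˡ-≤ e (<⇒≤ (n%ℕd<d z m)) ,
        DWalk-resp ([z%m]*i≡z*i m z (+ gcdSum S T)) (DWalk-replicate (z %ℕ m) (proj₂ attainable-gcdSum))

    gcdSum∣defect : ∀ {s₁ u v ℓ} → s₁ ∈ S →
                    + gcdSum S T ∣ᵤ + toℕ v ℤ.- + toℕ u ℤ.- + (ℓ * s₁) → + gcdSum S T ∣ᶻ defect u v ℓ
    gcdSum∣defect {s₁} {u} {v} {ℓ} s₁∈S g∣ =
      subst (+ gcdSum S T ∣ᶻ_) eq (∣m∣n⇒∣m-n (∣n⇒∣m*n (+ ℓ) (∣m∣n⇒∣m-n g∣s+t g∣s₁+t)) g∣v-u-ℓs₁)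
      where
      U V : ℤ
      U = + toℕ u
      V = + toℕ v
      g∣s+t : + gcdSum S T ∣ᶻ + (s + t)
      g∣s+t = ∣ᵤ⇒∣ {i = + (s + t)} (gcdSum∣ s∈S t∈T)
      g∣s₁+t : + gcdSum S T ∣ᶻ + (s₁ + t)
      g∣s₁+t = ∣ᵤ⇒∣ {i = + (s₁ + t)} (gcdSum∣ s₁∈S t∈T)
      g∣v-u-ℓs₁ : + gcdSum S T ∣ᶻ V ℤ.- U ℤ.- + (ℓ * s₁)
      g∣v-u-ℓs₁ = ∣ᵤ⇒∣ {i = V ℤ.- U ℤ.- + (ℓ * s₁)} g∣
      lemma : ∀ ℓ s t s₁ u v → ℓ ℤ.* (s ℤ.+ t ℤ.- (s₁ ℤ.+ t)) ℤ.- (v ℤ.- u ℤ.- ℓ ℤ.* s₁) ≡ ℓ ℤ.* s ℤ.- (v ℤ.- u)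
      lemma = ℤ-Solver.solve-∀
      eq : + ℓ ℤ.* (+ (s + t) ℤ.- + (s₁ + t)) ℤ.- (V ℤ.- U ℤ.- + (ℓ * s₁)) ≡ defect u v ℓ
      eq = trans (cong (λ j → + ℓ ℤ.* (+ (s + t) ℤ.- + (s₁ + t)) ℤ.- (V ℤ.- U ℤ.- j)) (ℤₚ.pos-* ℓ s₁))
                 (lemma (+ ℓ) (+ s) (+ t) (+ s₁) U V)

    walkEnsured : WalkEnsured n S T
    walkEnsured = suc (B + (B′ + B)) , s≤s z≤n , walk
      where
      B B′ : ℕ
      B  = proj₁ connect
      B′ = proj₁ attainable-bounded
      walk : ∀ u v ℓ → suc (B + (B′ + B)) ≤ ℓ →
             + gcdSum S T ∣ᵤ + toℕ v ℤ.- + toℕ u ℤ.- + (ℓ * minL S) → Walk A u v ℓ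
      walk u v ℓ M≤ℓ g∣ =
        let (ℓ₁ , ℓ₁≤B , u→o) = proj₂ connect u o
            (e , e≤B′ , o→o) = proj₂ attainable-bounded (defect u v ℓ)
                                 (gcdSum∣defect {u = u} {v} {ℓ} (minL∈ (s , s∈S)) g∣)
            (ℓ₂ , ℓ₂≤B , o→v) = proj₂ connect o v
        in lengthen (subst (DWalk u v (ℓ₁ + (e + ℓ₂)))
                           (trans (ℤₚ.+-identityˡ (defect u v ℓ ℤ.+ 0ℤ)) (ℤₚ.+-identityʳ (defect u v ℓ)))
                           (u→o ++ᵈ o→o ++ᵈ o→v))
                    (≤-trans (+-mono-≤ ℓ₁≤B (+-mono-≤ e≤B′ ℓ₂≤B)) (<⇒≤ M≤ℓ))

theorem5p1 : (n : ℕ) → 1 ≤ n → (S T : List ℕ) →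
    S ⊆[ n -1] → T ⊆[ n -1] → NonEmpty S → NonEmpty T →
    (Σ ℕ λ s → Σ ℕ λ t → s ∈ S × t ∈ T × s + t ≤ n × gcd s t ≡ 1) →
    WalkEnsured n S T
-- 1 ≤ n and the nonemptiness of S and T already follow from s ∈ S and t ∈ T.
theorem5p1 n _ S T S⊆ T⊆ _ _ (s , t , s∈S , t∈T , s+t≤n , gcd[s,t]≡1) =
  ToeplitzWalks.walkEnsured S⊆ T⊆ s∈S t∈T s+t≤n (gcd≡1⇒coprime gcd[s,t]≡1)
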